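{- Let $m\ge 3$ be odd, $i$ a positive integer with $\gcd(i,m)=1$, and $q=2^i$. The polynomial $Q_1(T)=T^{q^2+q+1}+T+1$ has no roots in $\mathbb{F}_{2^m}$ if and only if $\gcd(m,7)=1$.
   Context: $\mathbb{F}_{2^m}$ is the finite field with $2^m$ elements. -}

module Defs where

open import Level using (Level; _⊔_)
open import Data.Nat using (ℕ; _^_)
import Data.Nat as ℕ
open import Data.Fin using (Fin)
open import Data.Product using (∃)
open import Relation.Nullary using (¬_)
open import Relation.Binary.PropositionalEquality as ≡ using (_≡_)
open import Algebra.Bundles using (CommutativeRing; Semiring)
open import Function.Bundles using (Inverse)
import Algebra.Definitions.RawSemiring as RawSemiringDefs

record IsField {c ℓ} (R : CommutativeRing c ℓ) : Set (c ⊔ ℓ) where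
  open CommutativeRing R
  field
    1≉0     : ¬ (1# ≈ 0#)
    inverse : ∀ x → ¬ (x ≈ 0#) → ∃ λ y → x * y ≈ 1#

HasCardinality : ∀ {c ℓ} (R : CommutativeRing c ℓ) → ℕ → Set (c ⊔ ℓ)
HasCardinality R n = Inverse (CommutativeRing.setoid R) (≡.setoid (Fin n))

IsFiniteField2^ : ∀ {c ℓ} (R : CommutativeRing c ℓ) → ℕ → Set (c ⊔ ℓ)
IsFiniteField2^ R m = IsField R Data.Product.× HasCardinality R (2 ^ m)
  where import Data.Product

Q₁ : ∀ {c ℓ} (R : CommutativeRing c ℓ) → ℕ → CommutativeRing.Carrier R → CommutativeRing.Carrier R
Q₁ R i x = x ^ᴿ e + x + 1#
  where
  open CommutativeRing R
  open RawSemiringDefs (Semiring.rawSemiring semiring) renaming (_^_ to _^ᴿ_)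
  q : ℕ
  q = 2 ℕ.^ i
  e : ℕ
  e = q ℕ.* q ℕ.+ q ℕ.+ 1

HasRootQ₁ : ∀ {c ℓ} (R : CommutativeRing c ℓ) → ℕ → Set (c ⊔ ℓ)
HasRootQ₁ R i = ∃ λ x → Q₁ R i x ≈ 0#
  where open CommutativeRing R

module Submission where

open import Defs
open import Data.Nat using (ℕ; _<_; _≤_; _%_)
open import Data.Nat.GCD using (gcd)
open import Relation.Nullary using (¬_)
open import Relation.Binary.PropositionalEquality using (_≡_)
open import Algebra.Bundles using (CommutativeRing)
open import Function.Bundles using (_⇔_)

open import Algebra.Bundles using (CommutativeMonoid)
import Algebra.Definitions as AlgebraDefinitions
import Algebra.Properties.CommutativeMonoid.Sum as CommutativeMonoidSum
import Algebra.Properties.CommutativeSemiring.Exp as CommutativeSemiringExp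
import Algebra.Properties.Ring as RingProperties
import Algebra.Properties.Semiring.Exp as SemiringExp
import Algebra.Properties.Semiring.Mult as SemiringMult
import Algebra.Solver.Ring as RingSolver
open import Algebra.Solver.Ring.AlmostCommutativeRing
  using (fromCommutativeRing; _-Raw-AlmostCommutative⟶_)
import Algebra.Solver.Ring.NaturalCoefficients.Default as SemiringSolver
open import Data.Bool using (Bool; true; false; if_then_else_; _∧_; _xor_; not; T; T?)
import Data.Bool as Bool
import Data.Bool.Properties as Bool
open import Data.Empty using (⊥-elim)
open import Data.Fin as Fin using (Fin; toℕ)
import Data.Fin.Properties as Fin
open import Data.Fin.Permutation using (permutation)
open import Data.List using (List; []; _∷_; length; foldr; map; replicate; _++_)
open import Data.List.Relation.Unary.All using (All; _∷_; all?)
open import Data.List.Relation.Unary.Any using (Any; here; there)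
open import Data.List.Relation.Unary.Any.Properties using (map⁻)
open import Data.Maybe using (Maybe; just; nothing)
import Data.Nat as ℕ
open import Data.Nat using (_∸_; _<ᵇ_; _≡ᵇ_; _/_)
import Data.Nat.Properties as ℕ
open import Data.Nat.Coprimality using (Coprime; coprime-divisor; coprime-Bézout; gcd≡1⇒coprime)
import Data.Nat.Coprimality as Coprime
open import Data.Nat.Divisibility using (_∣_; ∣-trans; divides; m%n≡0⇒n∣m)
open import Data.Nat.DivMod using (m%n<n; m≡m%n+[m/n]*n)
open import Data.Nat.GCD using (module Bézout; gcd[m,n]∣m; gcd[m,n]∣n)
open import Data.Nat.Primality using (Irreducible; prime⇒irreducible; prime?)
open import Data.Product using (_×_; _,_; proj₁; proj₂; ∃; Σ-syntax)
open import Data.Sum using (_⊎_; inj₁; inj₂; [_,_]′)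
open import Data.Unit using (tt)
open import Data.Vec using (Vec; []; _∷_; lookup; zipWith)
open import Data.Vec.Functional using (removeAt)
open import Function using (_∘_; id)
open import Function.Bundles using (Inverse; Equivalence; mk⇔)
open import Level using (_⊔_)
open import Relation.Binary using (Decidable)
open import Relation.Binary.PropositionalEquality using (_≢_)
import Relation.Binary.PropositionalEquality as ≡
open import Relation.Nullary using (yes; no; contradiction; ¬?; _×-dec_)
open import Relation.Nullary.Decidable using (Dec; from-yes)
import Relation.Nullary.Decidable as Dec

-- Write σ x = x ^ q. A root x of Q₁ satisfies x · σx · σ²x = x + 1, so its orbit
-- uₙ = σⁿ x obeys uₙ uₙ₊₁ uₙ₊₂ = uₙ + 1. In characteristic 2 this recurrence has period 7,
-- hence x ^ (q ^ 7) = x; together with x ^ (2 ^ m) = x and gcd (7 i, m) = 1 this forces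
-- x ∈ 𝔽₂, but neither 0 nor 1 is a root.
-- Conversely, if 7 ∣ m then F contains an element y ∉ 𝔽₂ with y ^ 128 = y (a value of the
-- trace to 𝔽₁₂₈, which cannot take only the values 0 and 1). Then y is a root of one of the
-- 18 irreducible septics over 𝔽₂, and a certificate, checked by evaluation, gives for each of
-- them and each q = 2, …, 2⁶ a root of Q₁ in 𝔽₁₂₈ as a polynomial in y. On 𝔽₁₂₈ the map σ
-- only depends on i mod 7, which is nonzero since gcd (i, m) = 1.

coprime-* : ∀ {a b c} → Coprime a c → Coprime b c → Coprime (a ℕ.* b) c
coprime-* {a} a⊥c b⊥c {d} (d∣ab , d∣c) = b⊥c (coprime-divisor d⊥a d∣ab , d∣c)
  where
  d⊥a : Coprime d a
  d⊥a (e∣d , e∣a) = a⊥c (e∣a , ∣-trans e∣d d∣c)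

m%[1+n]-view : ∀ m n → m % ℕ.suc n ≡ 0 ⊎ ∃ λ (k : Fin n) → m % ℕ.suc n ≡ ℕ.suc (toℕ k)
m%[1+n]-view m n with Fin.fromℕ< (m%n<n m (ℕ.suc n)) in eq
... | Fin.zero  = inj₁ (≡.trans (≡.sym (Fin.toℕ-fromℕ< _)) (≡.cong toℕ eq))
... | Fin.suc k = inj₂ (k , ≡.trans (≡.sym (Fin.toℕ-fromℕ< _)) (≡.cong toℕ eq))

module _ {a ℓ} (M : CommutativeMonoid a ℓ) where
  open CommutativeMonoid M
  open CommutativeMonoidSum M using (sum; sum-remove; sum-cong-≋; sum-replicate-zero)
  open import Relation.Binary.Reasoning.Setoid setoid

  sum-≈ε-except : ∀ {n} (i : Fin n) (t : Fin n → Carrier) →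
                  (∀ j → j ≢ i → t j ≈ ε) → sum t ≈ t i
  sum-≈ε-except {ℕ.suc n} i t t≈ε = begin
    sum t                     ≈⟨ sum-remove t ⟩
    t i ∙ sum (removeAt t i)  ≈⟨ ∙-congˡ (trans (sum-cong-≋ λ j → t≈ε _ (Fin.punchInᵢ≢i i j))
                                                 (sum-replicate-zero n)) ⟩
    t i ∙ ε                   ≈⟨ identityʳ (t i) ⟩
    t i                       ∎

module FieldProperties {c ℓ} (F : CommutativeRing c ℓ) (isField : IsField F) where
  open CommutativeRing F
  open IsField isField
  open AlgebraDefinitions _≈_ using (AlmostLeftCancellative)
  open RingProperties ring using (x∙y⁻¹≈ε⇒x≈y; //-rightDividesˡ)
  open SemiringExp semiring using (_^_)
  open SemiringSolver commutativeSemiring using (solve; _:+_; _:*_; _:=_; con)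
  open import Relation.Binary.Reasoning.Setoid setoid

  *-almostCancelˡ : AlmostLeftCancellative 0# _*_
  *-almostCancelˡ x y z x≉0 xy≈xz with inverse x x≉0
  ... | x⁻¹ , xx⁻¹≈1 = begin
    y               ≈⟨ unscale y ⟨
    x⁻¹ * (x * y)   ≈⟨ *-congˡ xy≈xz ⟩
    x⁻¹ * (x * z)   ≈⟨ unscale z ⟩
    z               ∎
    where
    unscale : ∀ w → x⁻¹ * (x * w) ≈ w
    unscale w = begin
      x⁻¹ * (x * w)  ≈⟨ *-assoc x⁻¹ x w ⟨
      x⁻¹ * x * w    ≈⟨ *-congʳ (trans (*-comm x⁻¹ x) xx⁻¹≈1) ⟩
      1# * w         ≈⟨ *-identityˡ w ⟩
      w              ∎

  *≈0⇒≈0 : ∀ {x y} → ¬ x ≈ 0# → x * y ≈ 0# → y ≈ 0#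
  *≈0⇒≈0 {x} {y} x≉0 xy≈0 = *-almostCancelˡ x y 0# x≉0 (trans xy≈0 (sym (zeroʳ x)))

  *-≉0 : ∀ {x y} → ¬ x ≈ 0# → ¬ y ≈ 0# → ¬ x * y ≈ 0#
  *-≉0 x≉0 y≉0 = y≉0 ∘ *≈0⇒≈0 x≉0

  horner : ∀ {d} → Vec Carrier d → Carrier → Carrier
  horner []       x = 0#
  horner (c ∷ cs) x = c + x * horner cs x

  monicHorner : ∀ {d} → Vec Carrier d → Carrier → Carrier
  monicHorner []       x = 1#
  monicHorner (c ∷ cs) x = c + x * monicHorner cs x

  monicHorner≈^+horner : ∀ {d} (cs : Vec Carrier d) x → monicHorner cs x ≈ x ^ d + horner cs x
  monicHorner≈^+horner []       x = sym (+-identityʳ 1#)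
  monicHorner≈^+horner {ℕ.suc d} (c ∷ cs) x = begin
    c + x * monicHorner cs x       ≈⟨ +-congˡ (*-congˡ (monicHorner≈^+horner cs x)) ⟩
    c + x * (x ^ d + horner cs x)  ≈⟨ solve 4 (λ c x p h →
                                        c :+ x :* (p :+ h) := x :* p :+ (c :+ x :* h))
                                        refl c x (x ^ d) (horner cs x) ⟩
    x * x ^ d + (c + x * horner cs x) ∎

  monicHorner-cong : ∀ {d} (cs : Vec Carrier d) {x y} →
                     x ≈ y → monicHorner cs x ≈ monicHorner cs y
  monicHorner-cong []       x≈y = refl
  monicHorner-cong (c ∷ cs) x≈y = +-congˡ (*-cong x≈y (monicHorner-cong cs x≈y))

  divide : ∀ {d} → Carrier → Vec Carrier (ℕ.suc d) → Vec Carrier d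
  divide a (c ∷ [])      = []
  divide a (c ∷ c′ ∷ cs) = monicHorner (c′ ∷ cs) a ∷ divide a (c′ ∷ cs)

  -- The point is written t + a so that the identity needs no subtraction.
  monicHorner-divide : ∀ {d} a (cs : Vec Carrier (ℕ.suc d)) t →
    monicHorner cs (t + a) ≈ t * monicHorner (divide a cs) (t + a) + monicHorner cs a
  monicHorner-divide a (c ∷ []) t =
    solve 3 (λ c t a → c :+ (t :+ a) :* con 1 := t :* con 1 :+ (c :+ a :* con 1)) refl c t a
  monicHorner-divide a (c ∷ c′ ∷ cs) t = begin
    c + (t + a) * monicHorner (c′ ∷ cs) (t + a)
      ≈⟨ +-congˡ (*-congˡ (monicHorner-divide a (c′ ∷ cs) t)) ⟩
    c + (t + a) * (t * q + p)
      ≈⟨ solve 5 (λ c t a q p → c :+ (t :+ a) :* (t :* q :+ p) := t :* (p :+ (t :+ a) :* q) :+ (c :+ a :* p))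
                 refl c t a q p ⟩
    t * (p + (t + a) * q) + (c + a * p)
      ∎
    where
    q = monicHorner (divide a (c′ ∷ cs)) (t + a)
    p = monicHorner (c′ ∷ cs) a

  monicHorner-roots≤degree : ∀ {n d} (cs : Vec Carrier d) (r : Fin n → Carrier) →
    (∀ {i j} → r i ≈ r j → i ≡ j) → (∀ j → monicHorner cs (r j) ≈ 0#) → n ℕ.≤ d
  monicHorner-roots≤degree {ℕ.zero}  _  _ _           _     = ℕ.z≤n
  monicHorner-roots≤degree {ℕ.suc n} [] r _           roots = contradiction (roots Fin.zero) 1≉0
  monicHorner-roots≤degree {ℕ.suc n} cs@(_ ∷ _) r r-injective roots =
    ℕ.s≤s (monicHorner-roots≤degree (divide a cs) (r ∘ Fin.suc)
             (Fin.suc-injective ∘ r-injective) quotient-roots)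
    where
    a = r Fin.zero
    quotient-roots : ∀ j → monicHorner (divide a cs) (r (Fin.suc j)) ≈ 0#
    quotient-roots j = trans (monicHorner-cong (divide a cs) r′≈t+a) (*≈0⇒≈0 t≉0 (begin
        t * monicHorner (divide a cs) (t + a)                      ≈⟨ +-identityʳ _ ⟨
        t * monicHorner (divide a cs) (t + a) + 0#                 ≈⟨ +-congˡ (roots Fin.zero) ⟨
        t * monicHorner (divide a cs) (t + a) + monicHorner cs a   ≈⟨ monicHorner-divide a cs t ⟨
        monicHorner cs (t + a)                                     ≈⟨ monicHorner-cong cs r′≈t+a ⟨
        monicHorner cs (r (Fin.suc j))                             ≈⟨ roots (Fin.suc j) ⟩
        0#                                                         ∎))
      where
      t = r (Fin.suc j) - a
      r′≈t+a : r (Fin.suc j) ≈ t + a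
      r′≈t+a = sym (//-rightDividesˡ a (r (Fin.suc j)))
      t≉0 : ¬ t ≈ 0#
      t≉0 t≈0 with r-injective (x∙y⁻¹≈ε⇒x≈y _ _ t≈0)
      ... | ()

  DegreeBelow : ℕ → (Carrier → Carrier) → Set (c ⊔ ℓ)
  DegreeBelow d f = Σ[ cs ∈ Vec Carrier d ] (∀ x → horner cs x ≈ f x)

  degreeBelow-cong : ∀ {d f g} → (∀ x → f x ≈ g x) → DegreeBelow d f → DegreeBelow d g
  degreeBelow-cong f≈g (cs , horner≈f) = cs , λ x → trans (horner≈f x) (f≈g x)

  degreeBelow-0# : ∀ d → DegreeBelow d (λ _ → 0#)
  degreeBelow-0# ℕ.zero    = [] , λ _ → refl
  degreeBelow-0# (ℕ.suc d) with degreeBelow-0# d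
  ... | cs , horner≈0 =
    0# ∷ cs , λ x → trans (+-identityˡ _) (trans (*-congˡ (horner≈0 x)) (zeroʳ x))

  degreeBelow-+ : ∀ {d f g} → DegreeBelow d f → DegreeBelow d g → DegreeBelow d (λ x → f x + g x)
  degreeBelow-+ (as , horner≈f) (bs , horner≈g) =
    zipWith _+_ as bs , λ x → trans (horner-zipWith as bs x) (+-cong (horner≈f x) (horner≈g x))
    where
    horner-zipWith : ∀ {d} (as bs : Vec Carrier d) x →
      horner (zipWith _+_ as bs) x ≈ horner as x + horner bs x
    horner-zipWith []       []       x = sym (+-identityʳ 0#)
    horner-zipWith (a ∷ as) (b ∷ bs) x = begin
      (a + b) + x * horner (zipWith _+_ as bs) x    ≈⟨ +-congˡ (*-congˡ (horner-zipWith as bs x)) ⟩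
      (a + b) + x * (horner as x + horner bs x)     ≈⟨ solve 5 (λ a b x p q →
                                                         (a :+ b) :+ x :* (p :+ q) :=
                                                         (a :+ x :* p) :+ (b :+ x :* q))
                                                         refl a b x (horner as x) (horner bs x) ⟩
      (a + x * horner as x) + (b + x * horner bs x) ∎

  degreeBelow-mono : ∀ {d d′ f} → d ℕ.≤ d′ → DegreeBelow d f → DegreeBelow d′ f
  degreeBelow-mono {d′ = d′} ℕ.z≤n ([] , horner≈f) = degreeBelow-cong horner≈f (degreeBelow-0# d′)
  degreeBelow-mono (ℕ.s≤s d≤d′) (c ∷ cs , horner≈f) with degreeBelow-mono d≤d′ (cs , λ _ → refl)
  ... | cs′ , horner′≈horner =
    c ∷ cs′ , λ x → trans (+-congˡ (*-congˡ (horner′≈horner x))) (horner≈f x)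

  degreeBelow-^ : ∀ {d k} → k ℕ.< d → DegreeBelow d (_^ k)
  degreeBelow-^ {ℕ.suc d} {ℕ.zero} _ with degreeBelow-0# d
  ... | cs , horner≈0 =
    1# ∷ cs , λ x → trans (+-congˡ (trans (*-congˡ (horner≈0 x)) (zeroʳ x))) (+-identityʳ 1#)
  degreeBelow-^ {ℕ.suc d} {ℕ.suc k} (ℕ.s≤s k<d) with degreeBelow-^ k<d
  ... | cs , horner≈^ = 0# ∷ cs , λ x → trans (+-identityˡ _) (*-congˡ (horner≈^ x))

  roots≤degree : ∀ {n d f} → DegreeBelow d f → (r : Fin n → Carrier) →
    (∀ {i j} → r i ≈ r j → i ≡ j) → (∀ j → r j ^ d + f (r j) ≈ 0#) → n ℕ.≤ d
  roots≤degree (cs , horner≈f) r r-injective roots =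
    monicHorner-roots≤degree cs r r-injective λ j →
      trans (monicHorner≈^+horner cs (r j)) (trans (+-congˡ (horner≈f (r j))) (roots j))

-- Polynomials over 𝔽₂ as coefficient lists, constant term first.
Poly₂ : Set
Poly₂ = List Bool

infixl 6 _+₂_
infixl 7 _*₂_

_+₂_ : Poly₂ → Poly₂ → Poly₂
[]      +₂ q       = q
(a ∷ p) +₂ []      = a ∷ p
(a ∷ p) +₂ (b ∷ q) = (a xor b) ∷ (p +₂ q)

_*₂_ : Poly₂ → Poly₂ → Poly₂
[]      *₂ q = []
(a ∷ p) *₂ q = (if a then q else []) +₂ (false ∷ p *₂ q)

one₂ : Poly₂
one₂ = true ∷ []

shift : ℕ → Poly₂ → Poly₂
shift k p = replicate k false ++ p

X^_ : ℕ → Poly₂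
X^ k = shift k one₂

product₂ : List Poly₂ → Poly₂
product₂ = foldr _*₂_ one₂

isZero₂ : Poly₂ → Bool
isZero₂ []      = true
isZero₂ (b ∷ p) = not b ∧ isZero₂ p

size : Poly₂ → ℕ
size []      = 0
size (b ∷ p) with size p
... | ℕ.zero  = if b then 1 else 0
... | ℕ.suc n = ℕ.suc (ℕ.suc n)

-- Long division by f, with fuel; soundness only uses that it adds multiples of f.
reduce : Poly₂ → ℕ → Poly₂ → Poly₂
reduce f ℕ.zero    p = p
reduce f (ℕ.suc n) p = if size p <ᵇ size f then p else reduce f n (p +₂ shift (size p ∸ size f) f)

_mod₂_ : Poly₂ → Poly₂ → Poly₂
p mod₂ f = reduce f (length p) p

frob₂ : Poly₂ → ℕ → Poly₂ → Poly₂
frob₂ f ℕ.zero    p = p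
frob₂ f (ℕ.suc k) p = frob₂ f k ((p *₂ p) mod₂ f)

-- Q₁ for q = 2 ^ k, evaluated at r in 𝔽₂[X]/(f).
Q₁₂ : Poly₂ → ℕ → Poly₂ → Poly₂
Q₁₂ f k r = ((((r₂ *₂ r₁) mod₂ f) *₂ r) mod₂ f +₂ (r +₂ one₂)) mod₂ f
  where
  r₁ = frob₂ f k r
  r₂ = frob₂ f k r₁

isRoot₂ : Poly₂ → ℕ → Poly₂ → Bool
isRoot₂ f k r = isZero₂ (Q₁₂ f k r) ∧ isZero₂ ((frob₂ f 7 r +₂ r) mod₂ f)

-- The binary digits of n, as the coefficients of a polynomial of degree < 8.
fromℕ₂ : ℕ → Poly₂
fromℕ₂ = digits 8
  where
  digits : ℕ → ℕ → Poly₂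
  digits ℕ.zero    n = []
  digits (ℕ.suc k) n = (n % 2 ≡ᵇ 1) ∷ digits k (n / 2)

-- The 18 irreducible polynomials f of degree 7 over 𝔽₂, each with r₁, …, r₆ such that rₖ is
-- a root of Q₁ for q = 2 ^ k in 𝔽₂[X]/(f) ≅ 𝔽₁₂₈.
certificate : List (ℕ × Vec ℕ 6)
certificate =
    (131 , 2 ∷ 8 ∷ 25 ∷ 10 ∷ 31 ∷ 28 ∷ [])
  ∷ (137 , 14 ∷ 28 ∷ 9 ∷ 24 ∷ 3 ∷ 10 ∷ [])
  ∷ (143 , 12 ∷ 39 ∷ 3 ∷ 8 ∷ 25 ∷ 33 ∷ [])
  ∷ (145 , 11 ∷ 6 ∷ 12 ∷ 27 ∷ 8 ∷ 2 ∷ [])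
  ∷ (157 , 29 ∷ 13 ∷ 24 ∷ 18 ∷ 30 ∷ 9 ∷ [])
  ∷ (167 , 12 ∷ 14 ∷ 23 ∷ 10 ∷ 9 ∷ 6 ∷ [])
  ∷ (171 , 10 ∷ 2 ∷ 7 ∷ 14 ∷ 13 ∷ 54 ∷ [])
  ∷ (185 , 15 ∷ 44 ∷ 8 ∷ 6 ∷ 24 ∷ 22 ∷ [])
  ∷ (191 , 29 ∷ 22 ∷ 10 ∷ 2 ∷ 12 ∷ 18 ∷ [])
  ∷ (193 , 12 ∷ 3 ∷ 7 ∷ 9 ∷ 11 ∷ 36 ∷ [])
  ∷ (203 , 10 ∷ 9 ∷ 22 ∷ 12 ∷ 14 ∷ 6 ∷ [])
  ∷ (211 , 8 ∷ 35 ∷ 10 ∷ 6 ∷ 30 ∷ 23 ∷ [])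
  ∷ (213 , 26 ∷ 23 ∷ 12 ∷ 3 ∷ 10 ∷ 18 ∷ [])
  ∷ (229 , 26 ∷ 11 ∷ 30 ∷ 18 ∷ 24 ∷ 8 ∷ [])
  ∷ (239 , 13 ∷ 6 ∷ 10 ∷ 28 ∷ 15 ∷ 3 ∷ [])
  ∷ (241 , 9 ∷ 27 ∷ 14 ∷ 30 ∷ 2 ∷ 12 ∷ [])
  ∷ (247 , 10 ∷ 44 ∷ 2 ∷ 12 ∷ 31 ∷ 50 ∷ [])
  ∷ (253 , 3 ∷ 15 ∷ 31 ∷ 12 ∷ 25 ∷ 27 ∷ [])
  ∷ []

CertifiedRoots : ℕ × Vec ℕ 6 → Set
CertifiedRoots (f , rs) = ∀ k → T (isRoot₂ (fromℕ₂ f) (ℕ.suc (toℕ k)) (fromℕ₂ (lookup rs k)))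

certificate-valid : All CertifiedRoots certificate
certificate-valid = from-yes (all? certifiedRoots? certificate)
  where
  certifiedRoots? : ∀ e → Dec (CertifiedRoots e)
  certifiedRoots? _ = Fin.all? λ _ → T? _

factors : List Poly₂
factors = X^ 1 ∷ X^ 1 +₂ one₂ ∷ map (fromℕ₂ ∘ proj₁) certificate

X¹²⁸+X-factorisation : T (isZero₂ (product₂ factors +₂ (X^ 128 +₂ X^ 1)))
X¹²⁸+X-factorisation = tt

HasCharacteristic2 : ∀ {c ℓ} → CommutativeRing c ℓ → Set ℓ
HasCharacteristic2 F = 1# + 1# ≈ 0#
  where open CommutativeRing F

module Characteristic2 {r ℓ} (F : CommutativeRing r ℓ) (isField : IsField F)
                       (1+1≈0 : HasCharacteristic2 F) where
  open CommutativeRing F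
  open IsField isField
  open FieldProperties F isField
  open SemiringExp semiring using (_^_; ^-congˡ; ^-assocʳ; ^-homo-*)
  open CommutativeSemiringExp commutativeSemiring using (^-distrib-*)
  open RingProperties ring using (+-inverseʳ-unique; -0#≈0#)
  open import Relation.Binary.Reasoning.Setoid setoid

  open CommutativeRing Bool.xor-∧-commutativeRing using () renaming (rawRing to 𝔽₂-rawRing)

  bit : Bool → Carrier
  bit false = 0#
  bit true  = 1#

  bit-xor : ∀ a b → bit (a xor b) ≈ bit a + bit b
  bit-xor false b     = sym (+-identityˡ (bit b))
  bit-xor true  false = sym (+-identityʳ 1#)
  bit-xor true  true  = sym 1+1≈0

  bit-∧ : ∀ a b → bit (a ∧ b) ≈ bit a * bit b
  bit-∧ false b = sym (zeroˡ (bit b))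
  bit-∧ true  b = sym (*-identityˡ (bit b))

  bit-homomorphism : 𝔽₂-rawRing -Raw-AlmostCommutative⟶ fromCommutativeRing F
  bit-homomorphism = record
    { ⟦_⟧    = bit
    ; +-homo = bit-xor
    ; *-homo = bit-∧
    ; -‿homo = -‿homo
    ; 0-homo = refl
    ; 1-homo = refl
    }
    where
    -‿homo : ∀ a → bit a ≈ - bit a
    -‿homo false = sym (-0#≈0#)
    -‿homo true  = +-inverseʳ-unique 1# 1# 1+1≈0

  bit-equal? : ∀ a b → Maybe (bit a ≈ bit b)
  bit-equal? a b with a Bool.≟ b
  ... | yes ≡.refl = just refl
  ... | no _       = nothing

  -- With coefficients in 𝔽₂ the solver also proves identities that hold only in characteristic 2.
  module 𝔽₂-Solver = RingSolver 𝔽₂-rawRing (fromCommutativeRing F) bit-homomorphism bit-equal?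
  open 𝔽₂-Solver using (solve) renaming (_:+_ to _⊕_; _:*_ to _⊗_; _:=_ to _⊜_; con to ι)

  x+y≈0⇒x≈y : ∀ {x y} → x + y ≈ 0# → x ≈ y
  x+y≈0⇒x≈y {x} {y} x+y≈0 = begin
    x            ≈⟨ solve 2 (λ x y → x ⊜ (x ⊕ y) ⊕ y) refl x y ⟩
    (x + y) + y  ≈⟨ +-congʳ x+y≈0 ⟩
    0# + y       ≈⟨ +-identityˡ y ⟩
    y            ∎

  x+x≈0 : ∀ x → x + x ≈ 0#
  x+x≈0 x = solve 1 (λ x → x ⊕ x ⊜ ι false) refl x

  frob : ℕ → Carrier → Carrier
  frob k x = x ^ (2 ℕ.^ k)

  frob-cong : ∀ k {x y} → x ≈ y → frob k x ≈ frob k y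
  frob-cong k = ^-congˡ (2 ℕ.^ k)

  frob-0 : ∀ x → frob 0 x ≈ x
  frob-0 = *-identityʳ

  frob-1 : ∀ x → frob 1 x ≈ x * x
  frob-1 x = *-congˡ (*-identityʳ x)

  frob-∘ : ∀ a b x → frob (a ℕ.+ b) x ≈ frob b (frob a x)
  frob-∘ a b x = begin
    x ^ (2 ℕ.^ (a ℕ.+ b))          ≡⟨ ≡.cong (x ^_) (ℕ.^-distribˡ-+-* 2 a b) ⟩
    x ^ (2 ℕ.^ a ℕ.* 2 ℕ.^ b)      ≈⟨ ^-assocʳ x (2 ℕ.^ a) (2 ℕ.^ b) ⟨
    (x ^ (2 ℕ.^ a)) ^ (2 ℕ.^ b)    ∎

  frob-comm : ∀ a b x → frob a (frob b x) ≈ frob b (frob a x)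
  frob-comm a b x = begin
    frob a (frob b x)   ≈⟨ frob-∘ b a x ⟨
    frob (b ℕ.+ a) x    ≡⟨ ≡.cong (λ k → frob k x) (ℕ.+-comm b a) ⟩
    frob (a ℕ.+ b) x    ≈⟨ frob-∘ a b x ⟩
    frob b (frob a x)   ∎

  frob-0# : ∀ k → frob k 0# ≈ 0#
  frob-0# k with 2 ℕ.^ k | ℕ.m^n>0 2 k
  ... | ℕ.suc _ | _ = zeroˡ _

  frob-1# : ∀ k → frob k 1# ≈ 1#
  frob-1# k = 1#^n≈1# (2 ℕ.^ k)
    where
    1#^n≈1# : ∀ n → 1# ^ n ≈ 1#
    1#^n≈1# ℕ.zero    = refl
    1#^n≈1# (ℕ.suc n) = trans (*-identityˡ _) (1#^n≈1# n)

  frob-* : ∀ k x y → frob k (x * y) ≈ frob k x * frob k y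
  frob-* k x y = ^-distrib-* x y (2 ℕ.^ k)

  frob-+ : ∀ k x y → frob k (x + y) ≈ frob k x + frob k y
  frob-+ ℕ.zero    x y = trans (frob-0 (x + y)) (sym (+-cong (frob-0 x) (frob-0 y)))
  frob-+ (ℕ.suc k) x y = begin
    frob (1 ℕ.+ k) (x + y)                 ≈⟨ frob-∘ 1 k (x + y) ⟩
    frob k (frob 1 (x + y))                ≈⟨ frob-cong k (trans (frob-1 (x + y)) freshman) ⟩
    frob k (frob 1 x + frob 1 y)           ≈⟨ frob-+ k (frob 1 x) (frob 1 y) ⟩
    frob k (frob 1 x) + frob k (frob 1 y)  ≈⟨ +-cong (frob-∘ 1 k x) (frob-∘ 1 k y) ⟨
    frob (1 ℕ.+ k) x + frob (1 ℕ.+ k) y    ∎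
    where
    freshman : (x + y) * (x + y) ≈ frob 1 x + frob 1 y
    freshman = trans (solve 2 (λ x y → (x ⊕ y) ⊗ (x ⊕ y) ⊜ x ⊗ x ⊕ y ⊗ y) refl x y)
                     (sym (+-cong (frob-1 x) (frob-1 y)))

  FixedBy : ℕ → Carrier → Set ℓ
  FixedBy k x = frob k x ≈ x

  fixedBy-+ : ∀ {x} a b → FixedBy a x → FixedBy b x → FixedBy (a ℕ.+ b) x
  fixedBy-+ a b a-fixed b-fixed = trans (frob-∘ a b _) (trans (frob-cong b a-fixed) b-fixed)

  fixedBy-* : ∀ {x} n a → FixedBy a x → FixedBy (n ℕ.* a) x
  fixedBy-* ℕ.zero    a _       = frob-0 _
  fixedBy-* (ℕ.suc n) a a-fixed = fixedBy-+ a (n ℕ.* a) a-fixed (fixedBy-* n a a-fixed)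

  fixedBy-+⁻ʳ : ∀ {x} a b → FixedBy a x → FixedBy (a ℕ.+ b) x → FixedBy b x
  fixedBy-+⁻ʳ a b a-fixed a+b-fixed =
    trans (sym (trans (frob-∘ a b _) (frob-cong b a-fixed))) a+b-fixed

  fixedBy-coprime : ∀ {x a b} → Coprime a b → FixedBy a x → FixedBy b x → FixedBy 1 x
  fixedBy-coprime {x} {a} {b} a⊥b a-fixed b-fixed = from-bézout (coprime-Bézout a⊥b)
    where
    from-1+k≡l : ∀ {k l} → FixedBy k x → FixedBy l x → 1 ℕ.+ k ≡ l → FixedBy 1 x
    from-1+k≡l {k} k-fixed l-fixed 1+k≡l =
      fixedBy-+⁻ʳ k 1 k-fixed (≡.subst (λ n → FixedBy n x) (≡.trans (≡.sym 1+k≡l) (ℕ.+-comm 1 k)) l-fixed)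
    from-bézout : Bézout.Identity 1 a b → FixedBy 1 x
    from-bézout (Bézout.+- u v 1+vb≡ua) = from-1+k≡l (fixedBy-* v b b-fixed) (fixedBy-* u a a-fixed) 1+vb≡ua
    from-bézout (Bézout.-+ u v 1+ua≡vb) = from-1+k≡l (fixedBy-* u a a-fixed) (fixedBy-* v b b-fixed) 1+ua≡vb

  fixedBy-1⇒≈1 : ∀ {x} → FixedBy 1 x → ¬ x ≈ 0# → x ≈ 1#
  fixedBy-1⇒≈1 {x} x²≈x x≉0 =
    *-almostCancelˡ x x 1# x≉0 (trans (sym (frob-1 x)) (trans x²≈x (sym (*-identityʳ x))))

  frob-fixedBy : ∀ {x d} k → FixedBy d x → FixedBy d (frob k x)
  frob-fixedBy {x} {d} k d-fixed = trans (frob-comm d k x) (frob-cong k d-fixed)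

  frob-% : ∀ {x} d .{{_ : ℕ.NonZero d}} i → FixedBy d x → frob i x ≈ frob (i % d) x
  frob-% {x} d i d-fixed = begin
    frob i x                               ≡⟨ ≡.cong (λ k → frob k x) i≡[i/d]d+i%d ⟩
    frob ((i / d) ℕ.* d ℕ.+ i % d) x       ≈⟨ frob-∘ ((i / d) ℕ.* d) (i % d) x ⟩
    frob (i % d) (frob ((i / d) ℕ.* d) x)  ≈⟨ frob-cong (i % d) (fixedBy-* (i / d) d d-fixed) ⟩
    frob (i % d) x                         ∎
    where
    i≡[i/d]d+i%d : i ≡ (i / d) ℕ.* d ℕ.+ i % d
    i≡[i/d]d+i%d = ≡.trans (m≡m%n+[m/n]*n i d) (ℕ.+-comm (i % d) _)

  Q₁σ : ℕ → Carrier → Carrier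
  Q₁σ i x = frob i (frob i x) * frob i x * x + x + 1#

  Q₁≈Q₁σ : ∀ i x → Q₁ F i x ≈ Q₁σ i x
  Q₁≈Q₁σ i x = +-congʳ (+-congʳ (begin
    x ^ (q ℕ.* q ℕ.+ q ℕ.+ 1)          ≈⟨ ^-homo-* x (q ℕ.* q ℕ.+ q) 1 ⟩
    x ^ (q ℕ.* q ℕ.+ q) * x ^ 1        ≈⟨ *-cong (^-homo-* x (q ℕ.* q) q) (frob-0 x) ⟩
    x ^ (q ℕ.* q) * x ^ q * x          ≈⟨ *-congʳ (*-congʳ (^-assocʳ x q q)) ⟨
    frob i (frob i x) * frob i x * x   ∎))
    where
    q = 2 ℕ.^ i

  IsRoot : ℕ → Carrier → Set ℓ
  IsRoot i x = Q₁σ i x ≈ 0#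

  frob-Q₁σ : ∀ k i x → frob k (Q₁σ i x) ≈ Q₁σ i (frob k x)
  frob-Q₁σ k i x = begin
    frob k (frob i (frob i x) * frob i x * x + x + 1#)
      ≈⟨ trans (frob-+ k _ _) (+-cong (frob-+ k _ _) (frob-1# k)) ⟩
    frob k (frob i (frob i x) * frob i x * x) + frob k x + 1#
      ≈⟨ +-congʳ (+-congʳ (trans (frob-* k _ _) (*-congʳ (frob-* k _ _)))) ⟩
    frob k (frob i (frob i x)) * frob k (frob i x) * frob k x + frob k x + 1#
      ≈⟨ +-congʳ (+-congʳ (*-congʳ (*-cong σσ (frob-comm k i x)))) ⟩
    frob i (frob i (frob k x)) * frob i (frob k x) * frob k x + frob k x + 1#
      ∎
    where
    σσ : frob k (frob i (frob i x)) ≈ frob i (frob i (frob k x))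
    σσ = trans (frob-comm k i _) (frob-cong i (frob-comm k i x))

  isRoot-frob : ∀ i {x} k → IsRoot i x → IsRoot i (frob k x)
  isRoot-frob i {x} k x-root = trans (sym (frob-Q₁σ k i x)) (trans (frob-cong k x-root) (frob-0# k))

  isRoot-% : ∀ {x} d .{{_ : ℕ.NonZero d}} i → FixedBy d x → IsRoot (i % d) x → IsRoot i x
  isRoot-% {x} d i d-fixed x-root = trans (+-congʳ (+-congʳ (*-congʳ (*-cong σσx≈ σx≈)))) x-root
    where
    σx≈ : frob i x ≈ frob (i % d) x
    σx≈ = frob-% d i d-fixed
    σσx≈ : frob i (frob i x) ≈ frob (i % d) (frob (i % d) x)
    σσx≈ = trans (frob-cong i σx≈) (frob-% d i (frob-fixedBy {d = d} (i % d) d-fixed))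

  module Recurrence
    (u : ℕ → Carrier) (recurrence : ∀ n → u n * u (ℕ.suc n) * u (ℕ.suc (ℕ.suc n)) ≈ u n + 1#) where

    u≉0 : ∀ n → ¬ u n ≈ 0#
    u≉0 n uₙ≈0 = 1≉0 (begin
      1#                                            ≈⟨ +-identityˡ 1# ⟨
      0# + 1#                                       ≈⟨ +-congʳ uₙ≈0 ⟨
      u n + 1#                                      ≈⟨ recurrence n ⟨
      u n * u (ℕ.suc n) * u (ℕ.suc (ℕ.suc n))       ≈⟨ *-congʳ (*-congʳ uₙ≈0) ⟩
      0# * u (ℕ.suc n) * u (ℕ.suc (ℕ.suc n))        ≈⟨ trans (*-congʳ (zeroˡ _)) (zeroˡ _) ⟩
      0#                                            ∎)

    u≉1 : ∀ n → ¬ u n ≈ 1#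
    u≉1 n uₙ≈1 = u≉0 (ℕ.suc (ℕ.suc n)) (*≈0⇒≈0 (u≉0 (ℕ.suc n)) (begin
      u (ℕ.suc n) * u (ℕ.suc (ℕ.suc n))             ≈⟨ *-identityˡ _ ⟨
      1# * (u (ℕ.suc n) * u (ℕ.suc (ℕ.suc n)))      ≈⟨ *-congʳ uₙ≈1 ⟨
      u n * (u (ℕ.suc n) * u (ℕ.suc (ℕ.suc n)))     ≈⟨ *-assoc _ _ _ ⟨
      u n * u (ℕ.suc n) * u (ℕ.suc (ℕ.suc n))       ≈⟨ recurrence n ⟩
      u n + 1#                                      ≈⟨ +-congʳ uₙ≈1 ⟩
      1# + 1#                                       ≈⟨ 1+1≈0 ⟩
      0#                                            ∎))

    -- From uₙ = β/α and uₙ₊₁ = δ/γ the recurrence gives uₙ₊₂ = γ(α + β)/(βδ).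
    next : ∀ n {α β γ δ y} → ¬ β ≈ 0# → α * u n ≈ β → γ * u (ℕ.suc n) ≈ δ →
           γ * (α + β) ≈ β * y → δ * u (ℕ.suc (ℕ.suc n)) ≈ y
    next n {α} {β} {γ} {δ} {y} β≉0 αu≈β γu′≈δ γ[α+β]≈βy = *-almostCancelˡ β _ y β≉0 (begin
      β * (δ * u″)                ≈⟨ *-cong αu≈β (*-congʳ γu′≈δ) ⟨
      (α * u n) * ((γ * u′) * u″) ≈⟨ solve 5 (λ α γ u u′ u″ →
                                       (α ⊗ u) ⊗ ((γ ⊗ u′) ⊗ u″) ⊜ α ⊗ γ ⊗ (u ⊗ u′ ⊗ u″))
                                       refl α γ (u n) u′ u″ ⟩
      α * γ * (u n * u′ * u″)     ≈⟨ *-congˡ (recurrence n) ⟩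
      α * γ * (u n + 1#)          ≈⟨ solve 3 (λ α γ u → α ⊗ γ ⊗ (u ⊕ ι true) ⊜ γ ⊗ (α ⊕ α ⊗ u))
                                       refl α γ (u n) ⟩
      γ * (α + α * u n)           ≈⟨ *-congˡ (+-congˡ αu≈β) ⟩
      γ * (α + β)                 ≈⟨ γ[α+β]≈βy ⟩
      β * y                       ∎)
      where
      u′ = u (ℕ.suc n)
      u″ = u (ℕ.suc (ℕ.suc n))

    ≉0-step : ∀ n {α β} → ¬ α ≈ 0# → α * u n ≈ β → ¬ β ≈ 0#
    ≉0-step n α≉0 αu≈β β≈0 = *-≉0 α≉0 (u≉0 n) (trans αu≈β β≈0)

    period-7 : u 7 ≈ u 0
    period-7 = trans (sym (*-identityˡ (u 7))) u₇
      where
      𝟙 = ι true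
      a = u 0
      b = u 1
      c = a * b + (a + 1#)
      d = a * b + 1#
      u₂ : a * b * u 2 ≈ a + 1#
      u₂ = recurrence 0
      a+1≉0 : ¬ a + 1# ≈ 0#
      a+1≉0 = ≉0-step 2 (*-≉0 (u≉0 0) (u≉0 1)) u₂
      u₃ : (a + 1#) * u 3 ≈ a * (b + 1#)
      u₃ = next 1 (u≉0 1) (*-identityˡ b) u₂
             (solve 2 (λ a b → a ⊗ b ⊗ (𝟙 ⊕ b) ⊜ b ⊗ (a ⊗ (b ⊕ 𝟙))) refl a b)
      a[b+1]≉0 : ¬ a * (b + 1#) ≈ 0#
      a[b+1]≉0 = ≉0-step 3 a+1≉0 u₃
      u₄ : a * (b + 1#) * u 4 ≈ c
      u₄ = next 2 a+1≉0 u₂ u₃ refl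
      c≉0 : ¬ c ≈ 0#
      c≉0 = ≉0-step 4 a[b+1]≉0 u₄
      u₅ : c * u 5 ≈ d
      u₅ = next 3 a[b+1]≉0 u₃ u₄
             (*-congˡ (solve 2 (λ a b → (a ⊕ 𝟙) ⊕ a ⊗ (b ⊕ 𝟙) ⊜ a ⊗ b ⊕ 𝟙) refl a b))
      d≉0 : ¬ d ≈ 0#
      d≉0 = ≉0-step 5 c≉0 u₅
      u₆ : d * u 6 ≈ 1#
      u₆ = next 4 c≉0 u₄ u₅
             (*-congˡ (solve 2 (λ a b → a ⊗ (b ⊕ 𝟙) ⊕ (a ⊗ b ⊕ (a ⊕ 𝟙)) ⊜ 𝟙) refl a b))
      u₇ : 1# * u 7 ≈ a
      u₇ = next 5 d≉0 u₅ u₆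
             (*-congˡ (solve 2 (λ a b → (a ⊗ b ⊕ (a ⊕ 𝟙)) ⊕ (a ⊗ b ⊕ 𝟙) ⊜ a) refl a b))

  orbit : ℕ → Carrier → ℕ → Carrier
  orbit i x ℕ.zero    = x
  orbit i x (ℕ.suc n) = frob i (orbit i x n)

  orbit≈frob : ∀ i x n → orbit i x n ≈ frob (n ℕ.* i) x
  orbit≈frob i x ℕ.zero    = sym (frob-0 x)
  orbit≈frob i x (ℕ.suc n) = begin
    frob i (orbit i x n)       ≈⟨ frob-cong i (orbit≈frob i x n) ⟩
    frob i (frob (n ℕ.* i) x)  ≈⟨ frob-∘ (n ℕ.* i) i x ⟨
    frob (n ℕ.* i ℕ.+ i) x     ≡⟨ ≡.cong (λ k → frob k x) (ℕ.+-comm (n ℕ.* i) i) ⟩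
    frob (i ℕ.+ n ℕ.* i) x     ∎

  isRoot⇒recurrence : ∀ i {x} → IsRoot i x → x * frob i x * frob i (frob i x) ≈ x + 1#
  isRoot⇒recurrence i {x} x-root = x+y≈0⇒x≈y (begin
    x * frob i x * frob i (frob i x) + (x + 1#)  ≈⟨ solve 4 (λ x σx σσx y →
                                                       x ⊗ σx ⊗ σσx ⊕ y ⊜ σσx ⊗ σx ⊗ x ⊕ y)
                                                       refl x (frob i x) (frob i (frob i x)) (x + 1#) ⟩
    frob i (frob i x) * frob i x * x + (x + 1#)  ≈⟨ +-assoc _ x 1# ⟨
    Q₁σ i x                                       ≈⟨ x-root ⟩
    0#                                            ∎)

  orbit-recurrence : ∀ i {x} → IsRoot i x →
    ∀ n → orbit i x n * orbit i x (ℕ.suc n) * orbit i x (ℕ.suc (ℕ.suc n)) ≈ orbit i x n + 1#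
  orbit-recurrence i {x} x-root n = isRoot⇒recurrence i (orbit-isRoot n)
    where
    orbit-isRoot : ∀ n → IsRoot i (orbit i x n)
    orbit-isRoot ℕ.zero    = x-root
    orbit-isRoot (ℕ.suc n) = isRoot-frob i i (orbit-isRoot n)

  isRoot⇒fixedBy-7* : ∀ i {x} → IsRoot i x → FixedBy (7 ℕ.* i) x
  isRoot⇒fixedBy-7* i {x} x-root = trans (sym (orbit≈frob i x 7)) period-7
    where open Recurrence (orbit i x) (orbit-recurrence i x-root)

  isRoot⇒∉𝔽₂ : ∀ i {x} → IsRoot i x → ¬ x ≈ 0# × ¬ x ≈ 1#
  isRoot⇒∉𝔽₂ i {x} x-root = u≉0 0 , u≉1 0
    where open Recurrence (orbit i x) (orbit-recurrence i x-root)

  eval₂ : Poly₂ → Carrier → Carrier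
  eval₂ []      y = 0#
  eval₂ (b ∷ p) y = bit b + y * eval₂ p y

  eval₂-+₂ : ∀ p q y → eval₂ (p +₂ q) y ≈ eval₂ p y + eval₂ q y
  eval₂-+₂ []      q       y = sym (+-identityˡ _)
  eval₂-+₂ (a ∷ p) []      y = sym (+-identityʳ _)
  eval₂-+₂ (a ∷ p) (b ∷ q) y = begin
    bit (a xor b) + y * eval₂ (p +₂ q) y
      ≈⟨ +-cong (bit-xor a b) (*-congˡ (eval₂-+₂ p q y)) ⟩
    (bit a + bit b) + y * (eval₂ p y + eval₂ q y)
      ≈⟨ solve 5 (λ a b y p q → (a ⊕ b) ⊕ y ⊗ (p ⊕ q) ⊜ (a ⊕ y ⊗ p) ⊕ (b ⊕ y ⊗ q))
                 refl (bit a) (bit b) y (eval₂ p y) (eval₂ q y) ⟩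
    (bit a + y * eval₂ p y) + (bit b + y * eval₂ q y)
      ∎

  eval₂-*₂ : ∀ p q y → eval₂ (p *₂ q) y ≈ eval₂ p y * eval₂ q y
  eval₂-*₂ []      q y = sym (zeroˡ _)
  eval₂-*₂ (a ∷ p) q y = begin
    eval₂ ((if a then q else []) +₂ (false ∷ p *₂ q)) y
      ≈⟨ eval₂-+₂ (if a then q else []) _ y ⟩
    eval₂ (if a then q else []) y + (0# + y * eval₂ (p *₂ q) y)
      ≈⟨ +-cong (eval₂-if a) (trans (+-identityˡ _) (*-congˡ (eval₂-*₂ p q y))) ⟩
    bit a * eval₂ q y + y * (eval₂ p y * eval₂ q y)
      ≈⟨ solve 4 (λ a q y p → a ⊗ q ⊕ y ⊗ (p ⊗ q) ⊜ (a ⊕ y ⊗ p) ⊗ q) refl (bit a) (eval₂ q y) y (eval₂ p y) ⟩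
    (bit a + y * eval₂ p y) * eval₂ q y
      ∎
    where
    eval₂-if : ∀ a → eval₂ (if a then q else []) y ≈ bit a * eval₂ q y
    eval₂-if false = sym (zeroˡ _)
    eval₂-if true  = sym (*-identityˡ _)

  eval₂-shift : ∀ k p y → eval₂ (shift k p) y ≈ y ^ k * eval₂ p y
  eval₂-shift ℕ.zero    p y = sym (*-identityˡ _)
  eval₂-shift (ℕ.suc k) p y = begin
    0# + y * eval₂ (shift k p) y   ≈⟨ +-identityˡ _ ⟩
    y * eval₂ (shift k p) y        ≈⟨ *-congˡ (eval₂-shift k p y) ⟩
    y * (y ^ k * eval₂ p y)        ≈⟨ *-assoc y (y ^ k) _ ⟨
    y * y ^ k * eval₂ p y          ∎

  eval₂-X^ : ∀ k y → eval₂ (X^ k) y ≈ y ^ k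
  eval₂-X^ k y = trans (eval₂-shift k one₂ y) (trans (*-congˡ eval₂-one₂) (*-identityʳ _))
    where
    eval₂-one₂ : eval₂ one₂ y ≈ 1#
    eval₂-one₂ = trans (+-congˡ (zeroʳ y)) (+-identityʳ 1#)

  eval₂-X : ∀ y → eval₂ (X^ 1) y ≈ y
  eval₂-X y = trans (eval₂-X^ 1 y) (frob-0 y)

  eval₂-X+1 : ∀ y → eval₂ (X^ 1 +₂ one₂) y ≈ y + 1#
  eval₂-X+1 y = trans (eval₂-+₂ (X^ 1) one₂ y) (+-cong (eval₂-X y) (eval₂-X^ 0 y))

  isZero₂⇒eval₂≈0 : ∀ p y → T (isZero₂ p) → eval₂ p y ≈ 0#
  isZero₂⇒eval₂≈0 []          y _      = refl
  isZero₂⇒eval₂≈0 (false ∷ p) y p-zero =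
    trans (+-identityˡ _) (trans (*-congˡ (isZero₂⇒eval₂≈0 p y p-zero)) (zeroʳ y))

  module _ {f y} (f[y]≈0 : eval₂ f y ≈ 0#) where

    eval₂-mod₂ : ∀ p → eval₂ (p mod₂ f) y ≈ eval₂ p y
    eval₂-mod₂ p = eval₂-reduce (length p) p
      where
      eval₂-reduce : ∀ n p → eval₂ (reduce f n p) y ≈ eval₂ p y
      eval₂-reduce ℕ.zero    p = refl
      eval₂-reduce (ℕ.suc n) p with size p <ᵇ size f
      ... | true  = refl
      ... | false = begin
        eval₂ (reduce f n (p +₂ shift k f)) y   ≈⟨ eval₂-reduce n _ ⟩
        eval₂ (p +₂ shift k f) y                ≈⟨ eval₂-+₂ p (shift k f) y ⟩
        eval₂ p y + eval₂ (shift k f) y         ≈⟨ +-congˡ (trans (eval₂-shift k f y) (*-zero-right f[y]≈0)) ⟩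
        eval₂ p y + 0#                          ≈⟨ +-identityʳ _ ⟩
        eval₂ p y                               ∎
        where
        k = size p ∸ size f
        *-zero-right : ∀ {a b} → b ≈ 0# → a * b ≈ 0#
        *-zero-right b≈0 = trans (*-congˡ b≈0) (zeroʳ _)

    eval₂-*₂-mod₂ : ∀ p q → eval₂ ((p *₂ q) mod₂ f) y ≈ eval₂ p y * eval₂ q y
    eval₂-*₂-mod₂ p q = trans (eval₂-mod₂ (p *₂ q)) (eval₂-*₂ p q y)

    eval₂-frob₂ : ∀ k p → eval₂ (frob₂ f k p) y ≈ frob k (eval₂ p y)
    eval₂-frob₂ ℕ.zero    p = sym (frob-0 _)
    eval₂-frob₂ (ℕ.suc k) p = begin
      eval₂ (frob₂ f k ((p *₂ p) mod₂ f)) y    ≈⟨ eval₂-frob₂ k _ ⟩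
      frob k (eval₂ ((p *₂ p) mod₂ f) y)       ≈⟨ frob-cong k (trans (eval₂-*₂-mod₂ p p) (sym (frob-1 _))) ⟩
      frob k (frob 1 (eval₂ p y))              ≈⟨ frob-∘ 1 k _ ⟨
      frob (ℕ.suc k) (eval₂ p y)               ∎

    eval₂-Q₁₂ : ∀ k r → eval₂ (Q₁₂ f k r) y ≈ Q₁σ k (eval₂ r y)
    eval₂-Q₁₂ k r = begin
      eval₂ (Q₁₂ f k r) y
        ≈⟨ trans (eval₂-mod₂ (p₁ +₂ (r +₂ one₂))) (eval₂-+₂ p₁ (r +₂ one₂) y) ⟩
      eval₂ ((((r₂ *₂ r₁) mod₂ f) *₂ r) mod₂ f) y + eval₂ (r +₂ one₂) y
        ≈⟨ +-cong (trans (eval₂-*₂-mod₂ ((r₂ *₂ r₁) mod₂ f) r) (*-congʳ (eval₂-*₂-mod₂ r₂ r₁)))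
                  (eval₂-+₂ r one₂ y) ⟩
      eval₂ r₂ y * eval₂ r₁ y * z + (z + eval₂ one₂ y)
        ≈⟨ +-cong (*-congʳ (*-cong (trans (eval₂-frob₂ k r₁) (frob-cong k (eval₂-frob₂ k r)))
                                   (eval₂-frob₂ k r)))
                  (+-congˡ (eval₂-X^ 0 y)) ⟩
      frob k (frob k z) * frob k z * z + (z + 1#)
        ≈⟨ +-assoc _ z 1# ⟨
      Q₁σ k z ∎
      where
      z = eval₂ r y
      r₁ = frob₂ f k r
      r₂ = frob₂ f k r₁
      p₁ = (((r₂ *₂ r₁) mod₂ f) *₂ r) mod₂ f

    isRoot₂-sound : ∀ k r → T (isRoot₂ f k r) → IsRoot k (eval₂ r y) × FixedBy 7 (eval₂ r y)
    isRoot₂-sound k r certified = root , fixed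
      where
      checks : T (isZero₂ (Q₁₂ f k r)) × T (isZero₂ ((frob₂ f 7 r +₂ r) mod₂ f))
      checks = Equivalence.to Bool.T-∧ certified
      root : IsRoot k (eval₂ r y)
      root = trans (sym (eval₂-Q₁₂ k r)) (isZero₂⇒eval₂≈0 (Q₁₂ f k r) y (proj₁ checks))
      fixed : FixedBy 7 (eval₂ r y)
      fixed = x+y≈0⇒x≈y (begin
        frob 7 (eval₂ r y) + eval₂ r y       ≈⟨ +-congʳ (eval₂-frob₂ 7 r) ⟨
        eval₂ (frob₂ f 7 r) y + eval₂ r y    ≈⟨ eval₂-+₂ (frob₂ f 7 r) r y ⟨
        eval₂ (frob₂ f 7 r +₂ r) y           ≈⟨ eval₂-mod₂ (frob₂ f 7 r +₂ r) ⟨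
        eval₂ ((frob₂ f 7 r +₂ r) mod₂ f) y  ≈⟨ isZero₂⇒eval₂≈0 ((frob₂ f 7 r +₂ r) mod₂ f) y (proj₂ checks) ⟩
        0#                                   ∎)

module FiniteField {c ℓ} (F : CommutativeRing c ℓ) (isField : IsField F)
                   (m : ℕ) (card : HasCardinality F (2 ℕ.^ m)) where
  open CommutativeRing F
  open IsField isField
  open FieldProperties F isField
  open Inverse card using (to; from; to-cong; strictlyInverseˡ; strictlyInverseʳ)
  open SemiringExp semiring using (_^_; ^-congˡ)
  open SemiringMult semiring using (×1-homo-*) renaming (_×_ to _×ᴿ_)
  open RingProperties ring using (+-identityˡ-unique; \\-leftDividesˡ; \\-leftDividesʳ)
  open CommutativeMonoidSum +-commutativeMonoid using (∑-distrib-+; sum-replicate) renaming (sum to ∑)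
  open CommutativeMonoidSum *-commutativeMonoid using ()
    renaming (sum to ∏; ∑-distrib-+ to ∏-distrib-*; sum-replicate to ∏-replicate; sum-cong-≋ to ∏-cong)
  open import Relation.Binary.Reasoning.Setoid setoid

  infix 4 _≟_
  _≟_ : Decidable _≈_
  x ≟ y = Dec.map′ to≡to⇒≈ to-cong (to x Fin.≟ to y)
    where
    to≡to⇒≈ : to x ≡ to y → x ≈ y
    to≡to⇒≈ tx≡ty =
      trans (sym (strictlyInverseʳ x)) (trans (reflexive (≡.cong from tx≡ty)) (strictlyInverseʳ y))

  from-injective : ∀ {i j} → from i ≈ from j → i ≡ j
  from-injective {i} {j} fi≈fj =
    ≡.trans (≡.sym (strictlyInverseˡ i)) (≡.trans (to-cong fi≈fj) (strictlyInverseˡ j))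

  ^≈0⇒≈0 : ∀ {x} k → x ^ k ≈ 0# → x ≈ 0#
  ^≈0⇒≈0     ℕ.zero    1≈0    = contradiction 1≈0 1≉0
  ^≈0⇒≈0 {x} (ℕ.suc k) xxᵏ≈0 with x ≟ 0#
  ... | yes x≈0 = x≈0
  ... | no  x≉0 = ^≈0⇒≈0 k (*≈0⇒≈0 x≉0 xxᵏ≈0)

  *≈0⇒⊎ : ∀ {x y} → x * y ≈ 0# → x ≈ 0# ⊎ y ≈ 0#
  *≈0⇒⊎ {x} xy≈0 with x ≟ 0#
  ... | yes x≈0 = inj₁ x≈0
  ... | no  x≉0 = inj₂ (*≈0⇒≈0 x≉0 xy≈0)

  module _ {a ℓ′} (M : CommutativeMonoid a ℓ′) where
    open CommutativeMonoid M using () renaming (Carrier to A; _≈_ to _≈ᴹ_; trans to transᴹ)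
    open CommutativeMonoidSum M using (sum; sum-permute; sum-cong-≋)

    sum-reindex : (σ τ : Carrier → Carrier) →
                  (∀ {x y} → x ≈ y → σ x ≈ σ y) → (∀ {x y} → x ≈ y → τ x ≈ τ y) →
                  (∀ x → σ (τ x) ≈ x) → (∀ x → τ (σ x) ≈ x) →
                  (h : Carrier → A) → (∀ {x y} → x ≈ y → h x ≈ᴹ h y) →
                  sum (h ∘ from) ≈ᴹ sum (h ∘ σ ∘ from)
    sum-reindex σ τ σ-cong τ-cong στ≈id τσ≈id h h-cong =
      transᴹ (sum-permute (h ∘ from) π) (sum-cong-≋ λ i → h-cong (strictlyInverseʳ (σ (from i))))
      where
      π = permutation (to ∘ σ ∘ from) (to ∘ τ ∘ from)
            (λ i → ≡.trans (to-cong (trans (σ-cong (strictlyInverseʳ _)) (στ≈id _))) (strictlyInverseˡ i))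
            (λ i → ≡.trans (to-cong (trans (τ-cong (strictlyInverseʳ _)) (τσ≈id _))) (strictlyInverseˡ i))

  -- Translating by x permutes the summands of ∑ y, leaving |F| · x behind.
  |F|×x≈0 : ∀ x → (2 ℕ.^ m) ×ᴿ x ≈ 0#
  |F|×x≈0 x = +-identityˡ-unique _ (∑ from) (begin
    (2 ℕ.^ m) ×ᴿ x + ∑ from         ≈⟨ +-congʳ (sum-replicate (2 ℕ.^ m) {x}) ⟨
    ∑ {2 ℕ.^ m} (λ _ → x) + ∑ from  ≈⟨ ∑-distrib-+ {2 ℕ.^ m} (λ _ → x) from ⟨
    ∑ (λ i → x + from i)            ≈⟨ sum-reindex +-commutativeMonoid (x +_) (- x +_) +-congˡ +-congˡ
                                         (\\-leftDividesˡ x) (\\-leftDividesʳ x) id id ⟨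
    ∑ from                          ∎)

  1+1≈0 : 1# + 1# ≈ 0#
  1+1≈0 = ^≈0⇒≈0 m (begin
    (1# + 1#) ^ m        ≈⟨ ^-congˡ m (+-congˡ (+-identityʳ 1#)) ⟨
    (2 ×ᴿ 1#) ^ m        ≈⟨ ×1#-^ 2 m ⟩
    (2 ℕ.^ m) ×ᴿ 1#      ≈⟨ |F|×x≈0 1# ⟩
    0#                   ∎)
    where
    ×1#-^ : ∀ n k → (n ×ᴿ 1#) ^ k ≈ (n ℕ.^ k) ×ᴿ 1#
    ×1#-^ n ℕ.zero    = sym (+-identityʳ 1#)
    ×1#-^ n (ℕ.suc k) = trans (*-congˡ (×1#-^ n k)) (sym (×1-homo-* n (n ℕ.^ k)))

  open Characteristic2 F isField 1+1≈0
  open 𝔽₂-Solver using (solve) renaming (_:+_ to _⊕_; _:*_ to _⊗_; _:=_ to _⊜_; con to ι)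

  private
    unitize : Carrier → Carrier
    unitize x with x ≟ 0#
    ... | yes _ = 1#
    ... | no  _ = x

    unitize-≉0 : ∀ x → ¬ unitize x ≈ 0#
    unitize-≉0 x with x ≟ 0#
    ... | yes _   = 1≉0
    ... | no  x≉0 = x≉0

    unitize-cong : ∀ {x y} → x ≈ y → unitize x ≈ unitize y
    unitize-cong {x} {y} x≈y with x ≟ 0# | y ≟ 0#
    ... | yes _   | yes _   = refl
    ... | yes x≈0 | no  y≉0 = contradiction (trans (sym x≈y) x≈0) y≉0
    ... | no  x≉0 | yes y≈0 = contradiction (trans x≈y y≈0) x≉0
    ... | no  _   | no  _   = x≈y

    at0 : Carrier → Carrier → Carrier
    at0 a x with x ≟ 0#
    ... | yes _ = a
    ... | no  _ = 1#

    unitize-* : ∀ {a} → ¬ a ≈ 0# → ∀ x → unitize (a * x) * at0 a x ≈ a * unitize x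
    unitize-* {a} a≉0 x with x ≟ 0# | a * x ≟ 0#
    ... | yes _   | yes _    = *-comm 1# a
    ... | yes x≈0 | no  ax≉0 = contradiction (trans (*-congˡ x≈0) (zeroʳ a)) ax≉0
    ... | no  x≉0 | yes ax≈0 = contradiction ax≈0 (*-≉0 a≉0 x≉0)
    ... | no  _   | no  _    = *-identityʳ (a * x)

    ∏-at0 : ∀ a → ∏ (at0 a ∘ from) ≈ a
    ∏-at0 a = trans (sum-≈ε-except *-commutativeMonoid (to 0#) (at0 a ∘ from) at0≈1) at0≈a
      where
      at0≈a : at0 a (from (to 0#)) ≈ a
      at0≈a with from (to 0#) ≟ 0#
      ... | yes _ = refl
      ... | no  ≉0 = contradiction (strictlyInverseʳ 0#) ≉0
      at0≈1 : ∀ i → i ≢ to 0# → at0 a (from i) ≈ 1#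
      at0≈1 i i≢to0 with from i ≟ 0#
      ... | yes fi≈0 = contradiction (≡.trans (≡.sym (strictlyInverseˡ i)) (to-cong fi≈0)) i≢to0
      ... | no  _    = refl

  -- Scaling by a permutes F, so P = ∏ unitize x = ∏ unitize (a x). Factorwise the latter is
  -- a · unitize x except at x = 0, which at0 corrects; hence P · a = a ^ |F| · P.
  fermat-≉0 : ∀ {a} → ¬ a ≈ 0# → a ^ (2 ℕ.^ m) ≈ a
  fermat-≉0 {a} a≉0 with inverse a a≉0
  ... | a⁻¹ , aa⁻¹≈1 = *-almostCancelˡ P _ _ (∏-≉0 (unitize-≉0 ∘ from)) (begin
    P * a ^ N                                          ≈⟨ *-comm P _ ⟩
    a ^ N * P                                          ≈⟨ *-congʳ (∏-replicate N) ⟨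
    ∏ {N} (λ _ → a) * P                                ≈⟨ ∏-distrib-* (λ _ → a) (unitize ∘ from) ⟨
    ∏ (λ i → a * unitize (from i))                     ≈⟨ ∏-cong (λ i → unitize-* a≉0 (from i)) ⟨
    ∏ (λ i → unitize (a * from i) * at0 a (from i))    ≈⟨ ∏-distrib-* (unitize ∘ (a *_) ∘ from) _ ⟩
    ∏ (unitize ∘ (a *_) ∘ from) * ∏ (at0 a ∘ from)     ≈⟨ *-cong P≈∏unitize[a*] (sym (∏-at0 a)) ⟨
    P * a                                              ∎)
    where
    N = 2 ℕ.^ m
    P = ∏ (unitize ∘ from)
    ∏-≉0 : ∀ {n} {f : Fin n → Carrier} → (∀ i → ¬ f i ≈ 0#) → ¬ ∏ f ≈ 0#
    ∏-≉0 {ℕ.zero}  f≉0 = 1≉0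
    ∏-≉0 {ℕ.suc n} f≉0 = *-≉0 (f≉0 Fin.zero) (∏-≉0 (f≉0 ∘ Fin.suc))
    a*a⁻¹* : ∀ x → a * (a⁻¹ * x) ≈ x
    a*a⁻¹* x = trans (sym (*-assoc a a⁻¹ x)) (trans (*-congʳ aa⁻¹≈1) (*-identityˡ x))
    a⁻¹*a* : ∀ x → a⁻¹ * (a * x) ≈ x
    a⁻¹*a* x = trans (sym (*-assoc a⁻¹ a x)) (trans (*-congʳ (trans (*-comm a⁻¹ a) aa⁻¹≈1)) (*-identityˡ x))
    P≈∏unitize[a*] : P ≈ ∏ (unitize ∘ (a *_) ∘ from)
    P≈∏unitize[a*] =
      sum-reindex *-commutativeMonoid (a *_) (a⁻¹ *_) *-congˡ *-congˡ a*a⁻¹* a⁻¹*a* unitize unitize-cong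

  fixedBy-m : ∀ x → FixedBy m x
  fixedBy-m x with x ≟ 0#
  ... | yes x≈0 = trans (frob-cong m x≈0) (trans (frob-0# m) (sym x≈0))
  ... | no  x≉0 = fermat-≉0 x≉0

  module Trace (d : ℕ) where
    trace : ℕ → Carrier → Carrier
    trace ℕ.zero    x = 0#
    trace (ℕ.suc l) x = trace l x + frob (l ℕ.* d) x

    frob-trace : ∀ l x → frob d (trace l x) ≈ trace l x + x + frob (l ℕ.* d) x
    frob-trace ℕ.zero    x = begin
      frob d 0#         ≈⟨ frob-0# d ⟩
      0#                ≈⟨ solve 1 (λ x → ι false ⊕ x ⊕ x ⊜ ι false) refl x ⟨
      0# + x + x        ≈⟨ +-congˡ (frob-0 x) ⟨
      0# + x + frob 0 x ∎
    frob-trace (ℕ.suc l) x = begin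
      frob d (trace l x + frob (l ℕ.* d) x)
        ≈⟨ frob-+ d _ _ ⟩
      frob d (trace l x) + frob d (frob (l ℕ.* d) x)
        ≈⟨ +-cong (frob-trace l x) frob-next ⟩
      (trace l x + x + frob (l ℕ.* d) x) + frob (ℕ.suc l ℕ.* d) x
        ≈⟨ solve 4 (λ t x f g → (t ⊕ x ⊕ f) ⊕ g ⊜ (t ⊕ f) ⊕ x ⊕ g) refl (trace l x) x _ _ ⟩
      (trace l x + frob (l ℕ.* d) x) + x + frob (ℕ.suc l ℕ.* d) x
        ∎
      where
      frob-next : frob d (frob (l ℕ.* d) x) ≈ frob (ℕ.suc l ℕ.* d) x
      frob-next = trans (sym (frob-∘ (l ℕ.* d) d x))
                        (reflexive (≡.cong (λ k → frob k x) (ℕ.+-comm (l ℕ.* d) d)))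

    degreeBelow-frob-trace : ∀ {e} → e < d → ∀ l →
                             DegreeBelow (2 ℕ.^ (l ℕ.* d)) (λ x → frob e (trace l x))
    degreeBelow-frob-trace {e} e<d ℕ.zero    = degreeBelow-cong (λ _ → sym (frob-0# e)) (degreeBelow-0# 1)
    degreeBelow-frob-trace {e} e<d (ℕ.suc l) =
      degreeBelow-cong (λ x → trans (+-congˡ (frob-∘ (l ℕ.* d) e x)) (sym (frob-+ e _ _)))
        (degreeBelow-+ (degreeBelow-mono (ℕ.^-monoʳ-≤ 2 (ℕ.m≤n+m (l ℕ.* d) d)) (degreeBelow-frob-trace e<d l))
                       (degreeBelow-^ (ℕ.^-monoʳ-< 2 (ℕ.n<1+n 1) ld+e<d+ld)))
      where
      ld+e<d+ld : l ℕ.* d ℕ.+ e < d ℕ.+ l ℕ.* d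
      ld+e<d+ld = ≡.subst (l ℕ.* d ℕ.+ e <_) (ℕ.+-comm (l ℕ.* d) d) (ℕ.+-monoʳ-< (l ℕ.* d) e<d)

  frob-1+id-𝔽₂ : ∀ {y} → y ≈ 0# ⊎ y ≈ 1# → frob 1 y + y ≈ 0#
  frob-1+id-𝔽₂ {y} y∈𝔽₂ =
    trans (+-congʳ (frob-1 y)) (trans (solve 1 (λ y → y ⊗ y ⊕ y ⊜ y ⊗ (y ⊕ ι true)) refl y) (vanish y∈𝔽₂))
    where
    vanish : y ≈ 0# ⊎ y ≈ 1# → y * (y + 1#) ≈ 0#
    vanish (inj₁ y≈0) = trans (*-congʳ y≈0) (zeroˡ _)
    vanish (inj₂ y≈1) = trans (*-congˡ (trans (+-congʳ y≈1) 1+1≈0)) (zeroʳ y)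

  -- The trace t to 𝔽_{2^d} lands in 𝔽_{2^d}, and t ^ 2 + t is a polynomial of degree D < |F|,
  -- so t cannot map all of F into 𝔽₂.
  module _ {d} (1<d : 1 < d) (j : ℕ) (m≡[1+j]d : m ≡ ℕ.suc j ℕ.* d) where
    open Trace d

    private
      t : Carrier → Carrier
      t = trace (ℕ.suc j)

      D : ℕ
      D = 2 ℕ.^ (j ℕ.* d ℕ.+ 1)

      B : Carrier → Carrier
      B x = frob 1 (trace j x) + trace j x + frob (j ℕ.* d) x

    trace-fixedBy : ∀ x → FixedBy d (t x)
    trace-fixedBy x = begin
      frob d (t x)                      ≈⟨ frob-trace (ℕ.suc j) x ⟩
      t x + x + frob (ℕ.suc j ℕ.* d) x  ≈⟨ +-congˡ (≡.subst (λ k → FixedBy k x) m≡[1+j]d (fixedBy-m x)) ⟩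
      t x + x + x                       ≈⟨ solve 2 (λ t x → t ⊕ x ⊕ x ⊜ t) refl (t x) x ⟩
      t x                               ∎

    frob-1+id-trace : ∀ x → frob 1 (t x) + t x ≈ x ^ D + B x
    frob-1+id-trace x = begin
      frob 1 (trace j x + frob (j ℕ.* d) x) + (trace j x + frob (j ℕ.* d) x)
        ≈⟨ +-congʳ (trans (frob-+ 1 _ _) (+-congˡ (sym (frob-∘ (j ℕ.* d) 1 x)))) ⟩
      (frob 1 (trace j x) + x ^ D) + (trace j x + frob (j ℕ.* d) x)
        ≈⟨ solve 4 (λ s y t f → (s ⊕ y) ⊕ (t ⊕ f) ⊜ y ⊕ (s ⊕ t ⊕ f)) refl _ (x ^ D) (trace j x) _ ⟩
      x ^ D + B x ∎

    B-degree : DegreeBelow D B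
    B-degree = degreeBelow-+ (degreeBelow-+ (lift (degreeBelow-frob-trace 1<d j))
                                            (degreeBelow-cong (frob-0 ∘ trace j)
                                                              (lift (degreeBelow-frob-trace 0<d j))))
                             (degreeBelow-^ 2^[jd]<D)
      where
      0<d = ℕ.<-trans ℕ.z<s 1<d
      2^[jd]<D = ℕ.^-monoʳ-< 2 (ℕ.n<1+n 1) (ℕ.m<m+n (j ℕ.* d) ℕ.z<s)
      lift : ∀ {f} → DegreeBelow (2 ℕ.^ (j ℕ.* d)) f → DegreeBelow D f
      lift = degreeBelow-mono (ℕ.<⇒≤ 2^[jd]<D)

    D<|F| : D < 2 ℕ.^ m
    D<|F| = ℕ.^-monoʳ-< 2 (ℕ.n<1+n 1) (≡.subst (j ℕ.* d ℕ.+ 1 <_) d+jd≡m (ℕ.+-monoʳ-< (j ℕ.* d) 1<d))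
      where
      d+jd≡m : j ℕ.* d ℕ.+ d ≡ m
      d+jd≡m = ≡.trans (ℕ.+-comm (j ℕ.* d) d) (≡.sym m≡[1+j]d)

    ∃-trace∉𝔽₂ : ∃ λ x → ¬ t x ≈ 0# × ¬ t x ≈ 1#
    ∃-trace∉𝔽₂ with Fin.any? (λ i → ¬? (t (from i) ≟ 0#) ×-dec ¬? (t (from i) ≟ 1#))
    ... | yes (i , t≉0 , t≉1) = from i , t≉0 , t≉1
    ... | no ∄ = contradiction (roots≤degree B-degree from from-injective vanishes) (ℕ.<⇒≱ D<|F|)
      where
      t∈𝔽₂ : ∀ i → t (from i) ≈ 0# ⊎ t (from i) ≈ 1#
      t∈𝔽₂ i with t (from i) ≟ 0# | t (from i) ≟ 1#
      ... | yes t≈0 | _       = inj₁ t≈0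
      ... | no  _   | yes t≈1 = inj₂ t≈1
      ... | no  t≉0 | no  t≉1 = contradiction (i , t≉0 , t≉1) ∄
      vanishes : ∀ i → from i ^ D + B (from i) ≈ 0#
      vanishes i = trans (sym (frob-1+id-trace (from i))) (frob-1+id-𝔽₂ (t∈𝔽₂ i))

  ∃-fixedBy-∉𝔽₂ : ∀ {d} → 1 < d → d ∣ m → 0 < m →
                  ∃ λ y → FixedBy d y × ¬ y ≈ 0# × ¬ y ≈ 1#
  ∃-fixedBy-∉𝔽₂ 1<d (divides ℕ.zero    m≡0)      0<m = contradiction (≡.subst (0 <_) m≡0 0<m) λ ()
  ∃-fixedBy-∉𝔽₂ 1<d (divides (ℕ.suc j) m≡[1+j]d) _   with ∃-trace∉𝔽₂ 1<d j m≡[1+j]d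
  ... | x , t≉0 , t≉1 = _ , trace-fixedBy 1<d j m≡[1+j]d x , t≉0 , t≉1

  eval₂-product₂≈0 : ∀ ps y → eval₂ (product₂ ps) y ≈ 0# → Any (λ p → eval₂ p y ≈ 0#) ps
  eval₂-product₂≈0 []       y 1≈0 = contradiction (trans (sym (eval₂-X^ 0 y)) 1≈0) 1≉0
  eval₂-product₂≈0 (p ∷ ps) y pps≈0 with *≈0⇒⊎ (trans (sym (eval₂-*₂ p (product₂ ps) y)) pps≈0)
  ... | inj₁ p≈0   = here p≈0
  ... | inj₂ ps≈0  = there (eval₂-product₂≈0 ps y ps≈0)

  eval₂-factors : ∀ {y} → FixedBy 7 y → eval₂ (product₂ factors) y ≈ 0#
  eval₂-factors {y} y-fixed = begin
    eval₂ (product₂ factors) y         ≈⟨ x+y≈0⇒x≈y (trans (sym (eval₂-+₂ (product₂ factors) X¹²⁸+X y))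
                                                          (isZero₂⇒eval₂≈0 (product₂ factors +₂ X¹²⁸+X) y
                                                                           X¹²⁸+X-factorisation)) ⟩
    eval₂ X¹²⁸+X y                     ≈⟨ eval₂-+₂ (X^ 128) (X^ 1) y ⟩
    eval₂ (X^ 128) y + eval₂ (X^ 1) y  ≈⟨ +-cong (eval₂-X^ 128 y) (eval₂-X^ 1 y) ⟩
    frob 7 y + frob 0 y                ≈⟨ +-cong y-fixed (frob-0 y) ⟩
    y + y                              ≈⟨ x+x≈0 y ⟩
    0#                                 ∎
    where
    X¹²⁸+X = X^ 128 +₂ X^ 1

  ∉𝔽₂⇒other-factor : ∀ {y fs} → ¬ y ≈ 0# → ¬ y ≈ 1# →
    Any (λ p → eval₂ p y ≈ 0#) (X^ 1 ∷ X^ 1 +₂ one₂ ∷ fs) → Any (λ p → eval₂ p y ≈ 0#) fs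
  ∉𝔽₂⇒other-factor {y} y≉0 _   (here y≈0)             = ⊥-elim (y≉0 (trans (sym (eval₂-X y)) y≈0))
  ∉𝔽₂⇒other-factor {y} _   y≉1 (there (here y+1≈0))   = ⊥-elim (y≉1 (x+y≈0⇒x≈y (trans (sym (eval₂-X+1 y)) y+1≈0)))
  ∉𝔽₂⇒other-factor     _   _   (there (there f[y]≈0)) = f[y]≈0

  HasRootIn𝔽₁₂₈ : ℕ → Set (c ⊔ ℓ)
  HasRootIn𝔽₁₂₈ k = ∃ λ z → IsRoot k z × FixedBy 7 z

  root-from-certificate : ∀ {y} cert → All CertifiedRoots cert →
                          Any (λ e → eval₂ (fromℕ₂ (proj₁ e)) y ≈ 0#) cert →
                          (k : Fin 6) → HasRootIn𝔽₁₂₈ (ℕ.suc (toℕ k))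
  root-from-certificate {y} ((f , rs) ∷ _) (roots ∷ _) (here f[y]≈0) k =
    eval₂ r y , isRoot₂-sound f[y]≈0 (ℕ.suc (toℕ k)) r (roots k)
    where r = fromℕ₂ (lookup rs k)
  root-from-certificate (_ ∷ cert) (_ ∷ valid) (there f[y]≈0) k = root-from-certificate cert valid f[y]≈0 k

  -- y is a root of X ^ 128 + X but not of X (X + 1), hence of one of the septics in the certificate.
  roots-in-𝔽₁₂₈ : ∀ {y} → FixedBy 7 y → ¬ y ≈ 0# → ¬ y ≈ 1# → (k : Fin 6) → HasRootIn𝔽₁₂₈ (ℕ.suc (toℕ k))
  roots-in-𝔽₁₂₈ {y} y-fixed y≉0 y≉1 = root-from-certificate certificate certificate-valid
    (map⁻ {f = fromℕ₂ ∘ proj₁} (∉𝔽₂⇒other-factor y≉0 y≉1 factors[y]≈0))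
    where
    factors[y]≈0 : Any (λ p → eval₂ p y ≈ 0#) factors
    factors[y]≈0 = eval₂-product₂≈0 factors y (eval₂-factors y-fixed)

  coprime⇒¬hasRootQ₁ : ∀ i → Coprime i m → Coprime m 7 → ¬ HasRootQ₁ F i
  coprime⇒¬hasRootQ₁ i i⊥m m⊥7 (x , Q₁[x]≈0) = proj₂ x∉𝔽₂ (fixedBy-1⇒≈1 x∈𝔽₂ (proj₁ x∉𝔽₂))
    where
    x-root : IsRoot i x
    x-root = trans (sym (Q₁≈Q₁σ i x)) Q₁[x]≈0
    x∉𝔽₂ : ¬ x ≈ 0# × ¬ x ≈ 1#
    x∉𝔽₂ = isRoot⇒∉𝔽₂ i x-root
    x∈𝔽₂ : FixedBy 1 x
    x∈𝔽₂ = fixedBy-coprime (coprime-* (Coprime.sym m⊥7) i⊥m) (isRoot⇒fixedBy-7* i x-root) (fixedBy-m x)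

  hasRootIn𝔽₁₂₈⇒hasRootQ₁ : ∀ i {k} → i % 7 ≡ k → HasRootIn𝔽₁₂₈ k → HasRootQ₁ F i
  hasRootIn𝔽₁₂₈⇒hasRootQ₁ i ≡.refl (z , z-root , z-fixed) =
    z , trans (Q₁≈Q₁σ i z) (isRoot-% 7 i z-fixed z-root)

  7∣m⇒hasRootQ₁ : ∀ i → Coprime i m → 7 ∣ m → 0 < m → HasRootQ₁ F i
  7∣m⇒hasRootQ₁ i i⊥m 7∣m 0<m = root-from (∃-fixedBy-∉𝔽₂ (ℕ.s≤s (ℕ.s≤s ℕ.z≤n)) 7∣m 0<m) (m%[1+n]-view i 6)
    where
    root-from : (∃ λ y → FixedBy 7 y × ¬ y ≈ 0# × ¬ y ≈ 1#) →
                i % 7 ≡ 0 ⊎ ∃ (λ (k : Fin 6) → i % 7 ≡ ℕ.suc (toℕ k)) → HasRootQ₁ F i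
    root-from _                         (inj₁ i%7≡0)         with i⊥m (m%n≡0⇒n∣m i 7 i%7≡0 , 7∣m)
    ... | ()
    root-from (y , y-fixed , y≉0 , y≉1) (inj₂ (k , i%7≡1+k)) =
      hasRootIn𝔽₁₂₈⇒hasRootQ₁ i i%7≡1+k (roots-in-𝔽₁₂₈ y-fixed y≉0 y≉1 k)

7-irreducible : Irreducible 7
7-irreducible = prime⇒irreducible (from-yes (prime? 7))

proposition2p9 : ∀ {c ℓ} (m i : ℕ) → 3 ≤ m → m % 2 ≡ 1 → 0 < i → gcd i m ≡ 1 →
    (F : CommutativeRing c ℓ) → IsFiniteField2^ F m →
    (¬ HasRootQ₁ F i) ⇔ (gcd m 7 ≡ 1)
proposition2p9 m i 3≤m _ _ gcd[i,m]≡1 F (isField , card) =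
  mk⇔ (λ ¬root → [ id , (λ gcd≡7 → contradiction (has-root gcd≡7) ¬root) ]′ gcd[m,7]≡1⊎7)
      (coprime⇒¬hasRootQ₁ i i⊥m ∘ gcd≡1⇒coprime)
  where
  open FiniteField F isField m card
  i⊥m : Coprime i m
  i⊥m = gcd≡1⇒coprime gcd[i,m]≡1
  gcd[m,7]≡1⊎7 : gcd m 7 ≡ 1 ⊎ gcd m 7 ≡ 7
  gcd[m,7]≡1⊎7 = 7-irreducible (gcd[m,n]∣n m 7)
  has-root : gcd m 7 ≡ 7 → HasRootQ₁ F i
  has-root gcd≡7 =
    7∣m⇒hasRootQ₁ i i⊥m (≡.subst (_∣ m) gcd≡7 (gcd[m,n]∣m m 7)) (ℕ.<-≤-trans ℕ.z<s 3≤m)
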